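{- Let $\mathrm{sort}$ be a sort function satisfying the characteristic property. For every type $T$, every relation $\leq$ on $T$, every $xs : \mathrm{list}\,T$ and every $x \in T$: $x$ is an element of $\mathrm{sort}_\leq\,xs$ if and only if $x$ is an element of $xs$.
   Context: Lists: $[]$ is the empty list, $x :: s$ is cons, $[x]$ is the singleton list, $\mathbin{+\!\!+}$ is concatenation. A "relation" $\leq$ on a type $T$ is a function $T \to T \to \mathrm{bool}$. The merge of two lists w.r.t. $\leq$ is defined by $[] \mathbin{\land\hspace{ -.45em}\land}_\leq ys = ys$, $xs \mathbin{\land\hspace{ -.45em}\land}_\leq [] = xs$, and $(x :: xs) \mathbin{\land\hspace{ -.45em}\land}_\leq (y :: ys) = x :: (xs \mathbin{\land\hspace{ -.45em}\land}_\leq (y :: ys))$ if $x \leq y$, and $= y :: ((x :: xs) \mathbin{\land\hspace{ -.45em}\land}_\leq ys)$ otherwise. A sort function $\mathrm{sort}$ assigns to every type $T$ and relation $\leq$ on $T$ a function $\mathrm{sort}_\leq : \mathrm{list}\,T \to \mathrm{list}\,T$. It satisfies the characteristic property if there is a polymorphic function $\mathrm{asort}$ of type $\forall (T\,R : \mathcal{U}), (R \to R \to R) \to (T \to R) \to R \to \mathrm{list}\,T \to R$ such that: (1) for all $T$, $\leq$, $xs$: $\mathrm{asort}\,(\mathbin{\land\hspace{ -.45em}\land}_\leq)\,(\lambda x.[x])\,[]\,xs = \mathrm{sort}_\leq\,xs$; (2) for all $T$, $xs$: $\mathrm{asort}\,(\mathbin{+\!\!+})\,(\lambda x.[x])\,[]\,xs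 = xs$; (3) $\mathrm{asort}$ is relationally parametric: for all types $T_1,T_2$ and relation $\sim_T \subseteq T_1 \times T_2$, all types $R_1,R_2$ and relation $\sim_R \subseteq R_1\times R_2$, all $m_i : R_i \to R_i \to R_i$ with $a_1 \sim_R a_2 \wedge b_1 \sim_R b_2 \Rightarrow m_1\,a_1\,b_1 \sim_R m_2\,a_2\,b_2$, all $s_i : T_i \to R_i$ with $x_1 \sim_T x_2 \Rightarrow s_1\,x_1 \sim_R s_2\,x_2$, all $e_i : R_i$ with $e_1 \sim_R e_2$, and all lists $xs_1 : \mathrm{list}\,T_1$, $xs_2 : \mathrm{list}\,T_2$ of equal length that are pointwise $\sim_T$-related, we have $\mathrm{asort}\,m_1\,s_1\,e_1\,xs_1 \sim_R \mathrm{asort}\,m_2\,s_2\,e_2\,xs_2$. -}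

module Defs where

open import Data.Bool using (Bool; true; false; if_then_else_)
open import Data.List using (List; []; _∷_; [_]; _++_)
open import Data.List.Relation.Binary.Pointwise using (Pointwise)
open import Relation.Binary.PropositionalEquality using (_≡_)

Rel : Set → Set
Rel T = T → T → Bool

-- merge of two lists w.r.t. a relation (leq), as in the paper:
--   [] ∧∧ ys = ys ; xs ∧∧ [] = xs ;
--   (x ∷ xs) ∧∧ (y ∷ ys) = x ∷ (xs ∧∧ (y ∷ ys))   if x ≤ y
--                        = y ∷ ((x ∷ xs) ∧∧ ys)   otherwise
merge : {T : Set} → Rel T → List T → List T → List T
merge {T} leq [] ys = ys
merge {T} leq (x ∷ xs) ys = go ys
  where
  go : List T → List T
  go [] = x ∷ xs
  go (y ∷ ys') = if leq x y then x ∷ merge leq xs (y ∷ ys') else y ∷ go ys'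

SortFun : Set₁
SortFun = (T : Set) → Rel T → List T → List T

ASort : Set₁
ASort = (T R : Set) → (R → R → R) → (T → R) → R → List T → R

Parametric : ASort → Set₁
Parametric asort =
  (T₁ T₂ : Set) (_~T_ : T₁ → T₂ → Set)
  (R₁ R₂ : Set) (_~R_ : R₁ → R₂ → Set)
  (m₁ : R₁ → R₁ → R₁) (m₂ : R₂ → R₂ → R₂) →
  (∀ {a₁ a₂ b₁ b₂} → a₁ ~R a₂ → b₁ ~R b₂ → m₁ a₁ b₁ ~R m₂ a₂ b₂) →
  (s₁ : T₁ → R₁) (s₂ : T₂ → R₂) →
  (∀ {x₁ x₂} → x₁ ~T x₂ → s₁ x₁ ~R s₂ x₂) →
  (e₁ : R₁) (e₂ : R₂) → e₁ ~R e₂ →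
  (xs₁ : List T₁) (xs₂ : List T₂) → Pointwise _~T_ xs₁ xs₂ →
  asort T₁ R₁ m₁ s₁ e₁ xs₁ ~R asort T₂ R₂ m₂ s₂ e₂ xs₂

record CharacteristicProperty (sort : SortFun) : Set₁ where
  field
    asort      : ASort
    asort-sort : (T : Set) (leq : Rel T) (xs : List T) →
                 asort T (List T) (merge leq) [_] [] xs ≡ sort T leq xs
    asort-cat  : (T : Set) (xs : List T) →
                 asort T (List T) _++_ [_] [] xs ≡ xs
    asort-param : Parametric asort

-- Parametricity, instantiated at the relation "is a permutation of" between lists, relates the
-- merge-based instance of asort (which is sort) to the concatenation-based one (which is the
-- identity), because merging is a permutation of concatenating. So sort permutes its input, and
-- permutations preserve membership.
module Submission where

open import Defs
open import Data.Bool using (true; false)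
open import Data.List using (List; []; _∷_; [_]; _++_)
open import Data.List.Properties using (++-identityʳ)
open import Data.List.Membership.Propositional using (_∈_)
open import Data.List.Relation.Binary.Permutation.Propositional
  using (_↭_; ↭-refl; ↭-reflexive; ↭-sym; ↭-trans; prep)
open import Data.List.Relation.Binary.Permutation.Propositional.Properties
  using (++⁺; shift; ∈-resp-↭)
import Data.List.Relation.Binary.Pointwise as Pointwise
open import Function.Bundles using (_⇔_; mk⇔)
open import Relation.Binary.PropositionalEquality using (_≡_; refl; sym; subst)

module _ {T : Set} (leq : Rel T) where

  merge-↭-++ : (xs ys : List T) → merge leq xs ys ↭ xs ++ ys
  merge-↭-++ [] ys = ↭-refl
  -- Recursion nested like that of merge itself; a flat two-argument match fails the termination check.
  merge-↭-++ (x ∷ xs) = go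
    where
    go : (ys : List T) → merge leq (x ∷ xs) ys ↭ x ∷ xs ++ ys
    go [] = ↭-reflexive (sym (++-identityʳ (x ∷ xs)))
    go (y ∷ ys) with leq x y
    ... | true  = prep x (merge-↭-++ xs (y ∷ ys))
    ... | false = ↭-trans (prep y (go ys)) (↭-sym (shift y (x ∷ xs) ys))

sort-↭ : (sort : SortFun) → CharacteristicProperty sort →
         (T : Set) (leq : Rel T) (xs : List T) → sort T leq xs ↭ xs
sort-↭ sort cp T leq xs =
  subst (_↭ xs) (asort-sort T leq xs)
    (subst (asort T (List T) (merge leq) [_] [] xs ↭_) (asort-cat T xs) asort-merge-↭-asort-++)
  where
  open CharacteristicProperty cp

  merge-↭-cat : ∀ {a₁ a₂ b₁ b₂} → a₁ ↭ a₂ → b₁ ↭ b₂ → merge leq a₁ b₁ ↭ a₂ ++ b₂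
  merge-↭-cat {a₁} {b₁ = b₁} a₁↭a₂ b₁↭b₂ = ↭-trans (merge-↭-++ leq a₁ b₁) (++⁺ a₁↭a₂ b₁↭b₂)

  singleton-↭ : ∀ {x₁ x₂ : T} → x₁ ≡ x₂ → [ x₁ ] ↭ [ x₂ ]
  singleton-↭ refl = ↭-refl

  asort-merge-↭-asort-++ : asort T (List T) (merge leq) [_] [] xs ↭ asort T (List T) _++_ [_] [] xs
  asort-merge-↭-asort-++ = asort-param T T _≡_ (List T) (List T) _↭_ (merge leq) _++_ merge-↭-cat
                [_] [_] singleton-↭ [] [] ↭-refl xs xs (Pointwise.refl refl)

corollary3p8 : (sort : SortFun) → CharacteristicProperty sort →
    (T : Set) (leq : Rel T) (xs : List T) (x : T) →
    (x ∈ sort T leq xs) ⇔ (x ∈ xs)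
corollary3p8 sort cp T leq xs x =
  mk⇔ (∈-resp-↭ sort↭xs) (∈-resp-↭ (↭-sym sort↭xs))
  where
  sort↭xs : sort T leq xs ↭ xs
  sort↭xs = sort-↭ sort cp T leq xs
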